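{- Let $b>0$ be an integer and let $\gamma=c-\frac{a}{b}$ with $c\in\mathbb{Z}$, $a\in\{1,\ldots,b\}$, and $\gamma\notin\mathbb{Z}_{\ge0}$. Define $N_\gamma=\max\!\left(c,\lceil\frac{bc}{b-a}\rceil\right)$ if $c\ge1$ and $N_\gamma=\max\!\left(-c,\lceil\frac{ -bc}{a}\rceil\right)$ if $c\le0$. Then for every prime $p>N_\gamma$ with $p\equiv1\pmod b$ we have $\mathrm{rem}_p(\gamma)=c+\frac{(p-1)a}{b}$.
   Context: For a prime $p$, $\mathbb{Z}_{(p)}=\{x/y: x,y\in\mathbb{Z},\,p\nmid y\}$ and $\mathrm{rem}_p:\mathbb{Z}_{(p)}\to\{0,\ldots,p-1\}$ is the map $\mathrm{rem}_p(x/y)=xy^{ -1}\bmod p$. (In the paper $b$ is the least common denominator of a fixed finite multiset of rationals in $\mathbb{Q}\setminus\mathbb{Z}_{\ge0}$ containing $\gamma$, and $c-\frac{a}{b}$ is called the canonical representation of $\gamma$.) -}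

module Defs where

open import Data.Nat as ℕ using (ℕ; zero; suc; _⊔_)
open import Data.Nat.DivMod using (_/_)
open import Data.Integer as ℤ using (ℤ; +_; -[1+_]; +[1+_]; _-_; _*_; _≤_; _<_)
open import Data.Integer.Divisibility using (_∣_)
open import Data.Product using (_×_)

-- Ceiling division ⌈ m / d ⌉ on naturals (value at d = 0 is an irrelevant junk value 0).
ceilDiv : ℕ → ℕ → ℕ
ceilDiv m zero    = 0
ceilDiv m (suc k) = (m ℕ.+ k) / suc k

Nγ : (b : ℕ) (c : ℤ) (a : ℕ) → ℕ
Nγ b (+ zero)    a = 0 ⊔ ceilDiv (b ℕ.* 0) a
Nγ b +[1+ n ]    a = suc n ⊔ ceilDiv (b ℕ.* suc n) (b ℕ.∸ a)
Nγ b -[1+ n ]    a = suc n ⊔ ceilDiv (b ℕ.* suc n) a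

-- rem_p(x / y) = r  means  r = x y⁻¹ mod p, i.e. r ∈ {0,…,p-1} and y r ≡ x (mod p).
IsRem : (p : ℕ) (x y : ℤ) (r : ℤ) → Set
IsRem p x y r = (+ 0 ≤ r) × (r < + p) × ((+ p) ∣ (x - y * r))

{-# OPTIONS --safe #-}
module Submission where

open import Defs
open import Data.Nat as ℕ using (ℕ; NonZero; _≤_; _>_; zero; suc; z≤n; s≤s; s≤s⁻¹)
open import Data.Nat.DivMod using (_/_; _%_; m≡m%n+[m/n]*n; m%n<n; m*n/n≡m)
open import Data.Nat.Primality using (Prime)
open import Data.Integer as ℤ using (ℤ; +_; _-_; _*_; _+_; -[1+_]; +[1+_]; +≤+; +<+)
open import Data.Integer.Divisibility using (divides) renaming (_∣_ to _∣ℤ_)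
open import Data.Integer.Solver using (module +-*-Solver)
open import Data.Product using (∃; _,_)
open import Data.Sum using (inj₁; inj₂)
open import Relation.Nullary using (¬_; contradiction)
open import Relation.Binary.PropositionalEquality
import Data.Nat.Properties as ℕₚ
import Data.Integer.Properties as ℤₚ

-- Write p = 1 + k b. Then b (c + k a) = b c − a + a p, so r = c + k a satisfies b r ≡ b c − a
-- (mod p), and the remainder claim reduces to 0 ≤ c + k a ≤ k b. Since p > N_γ we have
-- ⌈b|c|/d⌉ ≤ k b, i.e. |c| ≤ k d, where d = a when c < 0 (giving the lower bound) and
-- d = b − a when c > 0 (giving the upper bound; b − a > 0 because γ ∉ ℤ≥0).

m≤ceilDiv[m,n]*n : ∀ m n .{{_ : NonZero n}} → m ≤ ceilDiv m n ℕ.* n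
m≤ceilDiv[m,n]*n m n@(suc j) = ℕₚ.+-cancelʳ-≤ j m _ (begin
  m ℕ.+ j         ≡⟨ m≡m%n+[m/n]*n (m ℕ.+ j) n ⟩
  r ℕ.+ q ℕ.* n   ≤⟨ ℕₚ.+-monoˡ-≤ (q ℕ.* n) (s≤s⁻¹ (m%n<n (m ℕ.+ j) n)) ⟩
  j ℕ.+ q ℕ.* n   ≡⟨ ℕₚ.+-comm j (q ℕ.* n) ⟩
  q ℕ.* n ℕ.+ j   ∎)
  where
  open ℕₚ.≤-Reasoning
  q = (m ℕ.+ j) / n
  r = (m ℕ.+ j) % n

ceilDiv[b*m,n]≤k*b⇒m≤k*n : ∀ b n m k .{{_ : NonZero b}} .{{_ : NonZero n}} →
  ceilDiv (b ℕ.* m) n ≤ k ℕ.* b → m ≤ k ℕ.* n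
ceilDiv[b*m,n]≤k*b⇒m≤k*n b n m k h = ℕₚ.*-cancelˡ-≤ b (begin
  b ℕ.* m                   ≤⟨ m≤ceilDiv[m,n]*n (b ℕ.* m) n ⟩
  ceilDiv (b ℕ.* m) n ℕ.* n ≤⟨ ℕₚ.*-monoˡ-≤ n h ⟩
  k ℕ.* b ℕ.* n             ≡⟨ cong (ℕ._* n) (ℕₚ.*-comm k b) ⟩
  b ℕ.* k ℕ.* n             ≡⟨ ℕₚ.*-assoc b k n ⟩
  b ℕ.* (k ℕ.* n)           ∎)
  where open ℕₚ.≤-Reasoning

%≡1%⇒≡1+* : ∀ p b .{{_ : NonZero b}} → 1 ≤ p → p % b ≡ 1 % b → ∃ λ k → p ≡ suc (k ℕ.* b)
%≡1%⇒≡1+* (suc p) 1            _ _       = p , cong suc (sym (ℕₚ.*-identityʳ p))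
%≡1%⇒≡1+* p       b@(suc (suc _)) _ p%b≡1 =
  p / b , trans (m≡m%n+[m/n]*n p b) (cong (ℕ._+ p / b ℕ.* b) p%b≡1)

k*b*a/b≡k*a : ∀ b .{{_ : NonZero b}} k a → k ℕ.* b ℕ.* a / b ≡ k ℕ.* a
k*b*a/b≡k*a b k a = begin
  k ℕ.* b ℕ.* a / b   ≡⟨ cong (_/ b) (ℕₚ.*-assoc k b a) ⟩
  k ℕ.* (b ℕ.* a) / b ≡⟨ cong (λ x → k ℕ.* x / b) (ℕₚ.*-comm b a) ⟩
  k ℕ.* (a ℕ.* b) / b ≡⟨ cong (_/ b) (ℕₚ.*-assoc k a b) ⟨
  k ℕ.* a ℕ.* b / b   ≡⟨ m*n/n≡m (k ℕ.* a) b ⟩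
  k ℕ.* a             ∎
  where open ≡-Reasoning

open +-*-Solver

γ-numerator-shift : ∀ c b a k → c * b - a - b * (c + k * a) ≡ ℤ.- (a * (+ 1 + k * b))
γ-numerator-shift = solve 4
  (λ c b a k → c :* b :- a :- b :* (c :+ k :* a) := :- (a :* (con (+ 1) :+ k :* b))) refl

1+k*b∣γ-numerator-shift : ∀ c b a k →
  + suc (k ℕ.* b) ∣ℤ c * + b - + a - + b * (c + + (k ℕ.* a))
1+k*b∣γ-numerator-shift c b a k = divides a (begin
  ℤ.∣ c * + b - + a - + b * (c + + (k ℕ.* a)) ∣
    ≡⟨ cong (λ x → ℤ.∣ c * + b - + a - + b * (c + x) ∣) (ℤₚ.pos-* k a) ⟩
  ℤ.∣ c * + b - + a - + b * (c + + k * + a) ∣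
    ≡⟨ cong ℤ.∣_∣ (γ-numerator-shift c (+ b) (+ a) (+ k)) ⟩
  ℤ.∣ ℤ.- (+ a * (+ 1 + + k * + b)) ∣
    ≡⟨ ℤₚ.∣-i∣≡∣i∣ (+ a * (+ 1 + + k * + b)) ⟩
  ℤ.∣ + a * (+ 1 + + k * + b) ∣
    ≡⟨ cong (λ x → ℤ.∣ + a * (+ 1 + x) ∣) (sym (ℤₚ.pos-* k b)) ⟩
  ℤ.∣ + a * + suc (k ℕ.* b) ∣
    ≡⟨ ℤₚ.abs-* (+ a) (+ suc (k ℕ.* b)) ⟩
  a ℕ.* suc (k ℕ.* b) ∎)
  where open ≡-Reasoning

γ∈ℕ-if-a≡b : ∀ n b → +[1+ n ] * + b - + b ≡ + b * + n
γ∈ℕ-if-a≡b n b = trans (cong (λ x → x * + b - + b) (ℤₚ.pos-+ 1 n))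
  (solve 2 (λ n b → (con (+ 1) :+ n) :* b :- b := b :* n) refl (+ n) (+ b))

0≤c+k*a : ∀ b c a k .{{_ : NonZero b}} .{{_ : NonZero a}} →
  Nγ b c a ≤ k ℕ.* b → + 0 ℤ.≤ c + + (k ℕ.* a)
0≤c+k*a b (+ _)      a k _ = +≤+ z≤n
0≤c+k*a b -[1+ n ] a k N≤kb =
  subst (+ 0 ℤ.≤_) (sym (ℤₚ.⊖-≥ |c|≤ka)) (+≤+ z≤n)
  where
  |c|≤ka : suc n ≤ k ℕ.* a
  |c|≤ka = ceilDiv[b*m,n]≤k*b⇒m≤k*n b a (suc n) k (ℕₚ.m⊔n≤o⇒n≤o (suc n) _ N≤kb)

c+k*a<1+k*b : ∀ b c a k .{{_ : NonZero b}} → a ≤ b →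
  ¬ (∃ λ (n : ℕ) → c * + b - + a ≡ + b * + n) →
  Nγ b c a ≤ k ℕ.* b → c + + (k ℕ.* a) ℤ.< + suc (k ℕ.* b)
c+k*a<1+k*b b (+ zero) a k a≤b _ _ = +<+ (s≤s (ℕₚ.*-monoʳ-≤ k a≤b))
c+k*a<1+k*b b -[1+ n ] a k a≤b _ _ =
  ℤₚ.≤-<-trans (ℤₚ.m⊖n≤m (k ℕ.* a) (suc n)) (+<+ (s≤s (ℕₚ.*-monoʳ-≤ k a≤b)))
c+k*a<1+k*b b +[1+ n ] a k a≤b γ∉ℕ N≤kb with ℕₚ.m≤n⇒m<n∨m≡n a≤b
... | inj₂ refl = contradiction (n , γ∈ℕ-if-a≡b n b) γ∉ℕ
... | inj₁ a<b = +<+ (s≤s (begin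
  suc n ℕ.+ k ℕ.* a           ≤⟨ ℕₚ.+-monoˡ-≤ (k ℕ.* a) c≤k[b-a] ⟩
  k ℕ.* (b ℕ.∸ a) ℕ.+ k ℕ.* a ≡⟨ ℕₚ.*-distribˡ-+ k (b ℕ.∸ a) a ⟨
  k ℕ.* (b ℕ.∸ a ℕ.+ a)       ≡⟨ cong (k ℕ.*_) (ℕₚ.m∸n+n≡m a≤b) ⟩
  k ℕ.* b                     ∎))
  where
  open ℕₚ.≤-Reasoning
  instance
    b-a≢0 : NonZero (b ℕ.∸ a)
    b-a≢0 = ℕ.>-nonZero (ℕₚ.m<n⇒0<n∸m a<b)
  c≤k[b-a] : suc n ≤ k ℕ.* (b ℕ.∸ a)
  c≤k[b-a] = ceilDiv[b*m,n]≤k*b⇒m≤k*n b (b ℕ.∸ a) (suc n) k (ℕₚ.m⊔n≤o⇒n≤o (suc n) _ N≤kb)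

proposition4p3 : (b : ℕ) → .{{_ : NonZero b}} → (c : ℤ) → (a : ℕ) → 1 ≤ a → a ≤ b →
    ¬ (∃ λ (n : ℕ) → c * + b - + a ≡ + b * + n) →
    (p : ℕ) → Prime p → p > Nγ b c a → p % b ≡ 1 ℕ.% b →
    IsRem p (c * + b - + a) (+ b) (c + + (((p ℕ.∸ 1) ℕ.* a) / b))
proposition4p3 b c a 1≤a a≤b γ∉ℕ p _ p>N p≡1
  with %≡1%⇒≡1+* p b (ℕₚ.<-≤-trans (s≤s z≤n) p>N) p≡1
... | k , refl rewrite k*b*a/b≡k*a b k a =
  0≤c+k*a b c a k N≤kb ,
  c+k*a<1+k*b b c a k a≤b γ∉ℕ N≤kb ,
  1+k*b∣γ-numerator-shift c b a k
  where
  N≤kb : Nγ b c a ≤ k ℕ.* b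
  N≤kb = s≤s⁻¹ p>N
  instance
    a≢0 : NonZero a
    a≢0 = ℕ.>-nonZero 1≤a
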